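{- Let $m$ be a nonnegative integer and let $\mathbf r=(r_0,r_1,\ldots)$ be the integer sequence with $r_0=1+m$ and $r_i=1$ for $i>0$. Then for positive integers $n$, \[C^{(\mathbf r)}(n,n)=(1+m)^n,\] and for positive integers $k<n$, \[C^{(\mathbf r)}(n,k)=\sum_{i=1}^{k}\binom{k}{i}\binom{n-k+i-1}{i-1}m^{k-i}.\]
   Context: For a sequence $\mathbf r=(r_0,r_1,\ldots)$ and nonnegative integers $k\le n$, $C^{(\mathbf r)}(n,k)$ is defined by $C^{(\mathbf r)}(0,0)=1$, $C^{(\mathbf r)}(n,0)=0$ for $n>0$, $C^{(\mathbf r)}(n,1)=r_{n-1}$ for $n\ge1$, and $C^{(\mathbf r)}(n,k)=\sum_{i=0}^{n-k}r_iC^{(\mathbf r)}(n-i-1,k-1)$ for $1<k\le n$ (with $C^{(\mathbf r)}(n,k)=0$ for $0<n<k$). (For nonnegative integer $r_i$, this counts generalized compositions of $n$ into $k$ parts where part $j$ comes in $r_{j-1}$ types; here there are $m+1$ kinds of $1$ and one kind of every other positive integer.) -}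

module Defs where

open import Data.Nat using (ℕ; zero; suc; _+_; _*_; _∸_; _^_; _<ᵇ_)
open import Data.Bool using (if_then_else_)
open import Data.Nat.Combinatorics using (_C_)

sumTo : ℕ → (ℕ → ℕ) → ℕ
sumTo zero    f = f 0
sumTo (suc n) f = sumTo n f + f (suc n)

sum1To : ℕ → (ℕ → ℕ) → ℕ
sum1To zero    f = 0
sum1To (suc n) f = sum1To n f + f (suc n)

-- generalized composition numbers C^(r)(n,k), by recursion on k:
--   C(0,0)=1, C(n,0)=0 for n>0, C(n,1)=r_{n-1} for n≥1,
--   C(n,k) = Σ_{i=0}^{n-k} r_i C(n-i-1,k-1) for 1<k≤n, and 0 for 0<n<k.
Comp : (ℕ → ℕ) → ℕ → ℕ → ℕ
Comp r zero    zero          = 1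
Comp r (suc n) zero          = 0
Comp r zero    (suc k)       = 0
Comp r (suc n) (suc zero)    = r n
Comp r (suc n) (suc (suc k)) =
  if suc n <ᵇ suc (suc k) then 0 else
  sumTo (suc n ∸ suc (suc k)) (λ i → r i * Comp r (suc n ∸ i ∸ 1) (suc k))

rSeq : ℕ → ℕ → ℕ
rSeq m zero    = 1 + m
rSeq m (suc i) = 1

-- Write n = k + a. Splitting off the first part gives
--   C(k+1+a, k+1) = Σ_{i≤a} r_i C(k+(a−i), k) = m·C(k+a, k) + Σ_{i≤a} C(k+(a−i), k),
-- since r_0 = 1 + m and r_i = 1 otherwise. So, as a sequence in a, C(k+a, k) is obtained
-- from δ_0 by applying k times the operator "m times the identity plus convolution with
-- the all-ones sequence". The two summands commute, so the binomial theorem gives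
--   C(k+a, k) = Σ_i C(k,i) m^{k−i} W(a,i),
-- where W(a,i) = C(a+i−1, i−1) (and W(a,0) = δ_0(a)) counts weak compositions of a into i
-- parts; convolving W(·,i) with the all-ones sequence gives W(·,i+1) by the hockey-stick
-- identity. For a ≥ 1 the term i = 0 vanishes; for a = 0 the recurrence is multiplication
-- by 1 + m.
module Submission where

open import Defs
open import Data.Nat using (ℕ; zero; suc; _+_; _*_; _∸_; _^_; _<_; _≤_; z≤n; _<ᵇ_)
open import Data.Nat.Properties
open import Data.Nat.Combinatorics using (_C_; nCn≡1; nCk+nC[k+1]≡[n+1]C[k+1]; k>n⇒nCk≡0)
open import Data.Bool using (false)
open import Data.Product using (_×_; _,_)
open import Relation.Binary.PropositionalEquality
  using (_≡_; refl; sym; trans; cong; cong₂; module ≡-Reasoning)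
open import Algebra.Properties.CommutativeSemigroup *-commutativeSemigroup using (xy∙z≈xz∙y; x∙yz≈y∙xz)
open import Algebra.Properties.CommutativeSemigroup +-commutativeSemigroup
  using () renaming (interchange to +-interchange)

open ≡-Reasoning

δ : ℕ → ℕ
δ zero    = 1
δ (suc _) = 0

sumTo-cong : ∀ n {f g : ℕ → ℕ} → (∀ i → i ≤ n → f i ≡ g i) → sumTo n f ≡ sumTo n g
sumTo-cong zero    f≗g = f≗g 0 z≤n
sumTo-cong (suc n) f≗g =
  cong₂ _+_ (sumTo-cong n (λ i i≤n → f≗g i (m≤n⇒m≤1+n i≤n))) (f≗g (suc n) ≤-refl)

sumTo-suc : ∀ n f → sumTo (suc n) f ≡ f 0 + sumTo n (λ i → f (suc i))
sumTo-suc zero    f = refl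
sumTo-suc (suc n) f = trans (cong (_+ f (suc (suc n))) (sumTo-suc n f))
  (+-assoc (f 0) (sumTo n (λ i → f (suc i))) (f (suc (suc n))))

sumTo-+ : ∀ n f g → sumTo n (λ i → f i + g i) ≡ sumTo n f + sumTo n g
sumTo-+ zero    f g = refl
sumTo-+ (suc n) f g = begin
    sumTo n (λ i → f i + g i) + (f (suc n) + g (suc n))
  ≡⟨ cong (_+ (f (suc n) + g (suc n))) (sumTo-+ n f g) ⟩
    (sumTo n f + sumTo n g) + (f (suc n) + g (suc n))
  ≡⟨ +-interchange (sumTo n f) (sumTo n g) (f (suc n)) (g (suc n)) ⟩
    (sumTo n f + f (suc n)) + (sumTo n g + g (suc n))
  ∎

*-distribˡ-sumTo : ∀ n c f → c * sumTo n f ≡ sumTo n (λ i → c * f i)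
*-distribˡ-sumTo zero    c f = refl
*-distribˡ-sumTo (suc n) c f =
  trans (*-distribˡ-+ c (sumTo n f) (f (suc n))) (cong (_+ c * f (suc n)) (*-distribˡ-sumTo n c f))

sumTo-swap : ∀ a k (h : ℕ → ℕ → ℕ) →
  sumTo a (λ j → sumTo k (λ i → h j i)) ≡ sumTo k (λ i → sumTo a (λ j → h j i))
sumTo-swap zero    k h = refl
sumTo-swap (suc a) k h = trans (cong (_+ sumTo k (h (suc a))) (sumTo-swap a k h))
  (sym (sumTo-+ k (λ i → sumTo a (λ j → h j i)) (h (suc a))))

sumTo-sift : ∀ a f → sumTo a (λ i → f i * δ (a ∸ i)) ≡ f a
sumTo-sift zero    f = *-identityʳ (f 0)
sumTo-sift (suc a) f = trans (sumTo-suc a (λ i → f i * δ (suc a ∸ i)))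
  (cong₂ _+_ (*-zeroʳ (f 0)) (sumTo-sift a (λ i → f (suc i))))

sumTo≡sum1To : ∀ n {f g : ℕ → ℕ} → f 0 ≡ 0 → (∀ i → f (suc i) ≡ g (suc i)) →
  sumTo n f ≡ sum1To n g
sumTo≡sum1To zero    f0≡0 f≗g = f0≡0
sumTo≡sum1To (suc n) f0≡0 f≗g = cong₂ _+_ (sumTo≡sum1To n f0≡0 f≗g) (f≗g n)

hockey-stick : ∀ a i → sumTo a (λ j → (a ∸ j + i) C i) ≡ (a + suc i) C suc i
hockey-stick zero    i = trans (nCn≡1 i) (sym (nCn≡1 (suc i)))
hockey-stick (suc a) i = begin
    sumTo (suc a) (λ j → (suc a ∸ j + i) C i)
  ≡⟨ sumTo-suc a (λ j → (suc a ∸ j + i) C i) ⟩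
    (suc a + i) C i + sumTo a (λ j → (a ∸ j + i) C i)
  ≡⟨ cong₂ _+_ (cong (_C i) (sym (+-suc a i))) (hockey-stick a i) ⟩
    (a + suc i) C i + (a + suc i) C suc i
  ≡⟨ nCk+nC[k+1]≡[n+1]C[k+1] (a + suc i) i ⟩
    (suc a + suc i) C suc i
  ∎

weakCompositions : ℕ → ℕ → ℕ
weakCompositions a zero    = δ a
weakCompositions a (suc i) = (a + i) C i

weakCompositions-suc : ∀ a i →
  sumTo a (λ j → weakCompositions (a ∸ j) i) ≡ weakCompositions a (suc i)
weakCompositions-suc a zero    =
  trans (sumTo-cong a (λ j _ → sym (*-identityˡ (δ (a ∸ j))))) (sumTo-sift a (λ _ → 1))
weakCompositions-suc a (suc i) = hockey-stick a i

binomialSum : ℕ → ℕ → (ℕ → ℕ) → ℕ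
binomialSum m k u = sumTo k (λ i → (k C i) * m ^ (k ∸ i) * u i)

binomialSum-cong : ∀ m k {u v : ℕ → ℕ} → (∀ i → u i ≡ v i) → binomialSum m k u ≡ binomialSum m k v
binomialSum-cong m k u≗v = sumTo-cong k (λ i _ → cong ((k C i) * m ^ (k ∸ i) *_) (u≗v i))

binomialSum-sumTo : ∀ m k a (v : ℕ → ℕ → ℕ) →
  sumTo a (λ j → binomialSum m k (v j)) ≡ binomialSum m k (λ i → sumTo a (λ j → v j i))
binomialSum-sumTo m k a v = trans (sumTo-swap a k (λ j i → (k C i) * m ^ (k ∸ i) * v j i))
  (sumTo-cong k (λ i _ → sym (*-distribˡ-sumTo a ((k C i) * m ^ (k ∸ i)) (λ j → v j i))))

*-binomialSum : ∀ m k u →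
  m * binomialSum m k u ≡ sumTo (suc k) (λ i → (k C i) * m ^ (suc k ∸ i) * u i)
*-binomialSum m k u = begin
    m * binomialSum m k u
  ≡⟨ *-distribˡ-sumTo k m (λ i → (k C i) * m ^ (k ∸ i) * u i) ⟩
    sumTo k (λ i → m * ((k C i) * m ^ (k ∸ i) * u i))
  ≡⟨ sumTo-cong k (λ i i≤k → absorb i i≤k) ⟩
    sumTo k s
  ≡⟨ sym (trans (cong (sumTo k s +_) top≡0) (+-identityʳ (sumTo k s))) ⟩
    sumTo (suc k) s
  ∎
  where
  s : ℕ → ℕ
  s i = (k C i) * m ^ (suc k ∸ i) * u i
  absorb : ∀ i → i ≤ k → m * ((k C i) * m ^ (k ∸ i) * u i) ≡ s i
  absorb i i≤k = begin
      m * ((k C i) * m ^ (k ∸ i) * u i)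
    ≡⟨ sym (*-assoc m ((k C i) * m ^ (k ∸ i)) (u i)) ⟩
      m * ((k C i) * m ^ (k ∸ i)) * u i
    ≡⟨ cong (_* u i) (x∙yz≈y∙xz m (k C i) (m ^ (k ∸ i))) ⟩
      (k C i) * m ^ suc (k ∸ i) * u i
    ≡⟨ cong (λ e → (k C i) * m ^ e * u i) (sym (+-∸-assoc 1 i≤k)) ⟩
      s i
    ∎
  top≡0 : s (suc k) ≡ 0
  top≡0 = cong (λ c → c * m ^ (k ∸ k) * u (suc k)) (k>n⇒nCk≡0 (n<1+n k))

binomialSum-suc : ∀ m k u →
  binomialSum m (suc k) u ≡ m * binomialSum m k u + binomialSum m k (λ i → u (suc i))
binomialSum-suc m k u = begin
    binomialSum m (suc k) u
  ≡⟨ sumTo-suc k (λ i → (suc k C i) * m ^ (suc k ∸ i) * u i) ⟩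
    s 0 + sumTo k (λ i → (suc k C suc i) * m ^ (k ∸ i) * u (suc i))
  ≡⟨ cong (s 0 +_) (sumTo-cong k (λ i _ → pascal i)) ⟩
    s 0 + sumTo k (λ i → t i + s (suc i))
  ≡⟨ cong (s 0 +_) (trans (sumTo-+ k t (λ i → s (suc i))) (+-comm (sumTo k t) _)) ⟩
    s 0 + (sumTo k (λ i → s (suc i)) + sumTo k t)
  ≡⟨ sym (+-assoc (s 0) (sumTo k (λ i → s (suc i))) (sumTo k t)) ⟩
    (s 0 + sumTo k (λ i → s (suc i))) + sumTo k t
  ≡⟨ cong (_+ sumTo k t) (sym (trans (*-binomialSum m k u) (sumTo-suc k s))) ⟩
    m * binomialSum m k u + binomialSum m k (λ i → u (suc i))
  ∎
  where
  s t : ℕ → ℕ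
  s i = (k C i) * m ^ (suc k ∸ i) * u i
  t i = (k C i) * m ^ (k ∸ i) * u (suc i)
  pascal : ∀ i → (suc k C suc i) * m ^ (k ∸ i) * u (suc i) ≡ t i + s (suc i)
  pascal i = begin
      (suc k C suc i) * m ^ (k ∸ i) * u (suc i)
    ≡⟨ cong (λ c → c * m ^ (k ∸ i) * u (suc i)) (sym (nCk+nC[k+1]≡[n+1]C[k+1] k i)) ⟩
      (k C i + k C suc i) * m ^ (k ∸ i) * u (suc i)
    ≡⟨ cong (_* u (suc i)) (*-distribʳ-+ (m ^ (k ∸ i)) (k C i) (k C suc i)) ⟩
      ((k C i) * m ^ (k ∸ i) + (k C suc i) * m ^ (k ∸ i)) * u (suc i)
    ≡⟨ *-distribʳ-+ (u (suc i)) ((k C i) * m ^ (k ∸ i)) ((k C suc i) * m ^ (k ∸ i)) ⟩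
      t i + s (suc i)
    ∎

Comp-zero : ∀ r n → Comp r n 0 ≡ δ n
Comp-zero r zero    = refl
Comp-zero r (suc n) = refl

m+n<ᵇm≡false : ∀ m n → (m + n <ᵇ m) ≡ false
m+n<ᵇm≡false zero    n = refl
m+n<ᵇm≡false (suc m) n = m+n<ᵇm≡false m n

Comp-suc : ∀ r k a → Comp r (suc k + a) (suc k) ≡ sumTo a (λ i → r i * Comp r (k + (a ∸ i)) k)
Comp-suc r zero    a =
  sym (trans (sumTo-cong a (λ i _ → cong (r i *_) (Comp-zero r (a ∸ i)))) (sumTo-sift a r))
Comp-suc r (suc k) a rewrite m+n<ᵇm≡false k a | m+n∸m≡n k a =
  sumTo-cong a (λ i i≤a → cong (λ n → r i * Comp r (n ∸ 1) (suc k)) (+-∸-assoc (suc (suc k)) i≤a))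

sumTo-rSeq : ∀ m a (g : ℕ → ℕ) → sumTo a (λ i → rSeq m i * g i) ≡ m * g 0 + sumTo a g
sumTo-rSeq m zero    g = +-comm (g 0) (m * g 0)
sumTo-rSeq m (suc a) g = begin
    sumTo (suc a) (λ i → rSeq m i * g i)
  ≡⟨ sumTo-suc a (λ i → rSeq m i * g i) ⟩
    (g 0 + m * g 0) + sumTo a (λ i → 1 * g (suc i))
  ≡⟨ cong₂ _+_ (+-comm (g 0) (m * g 0)) (sumTo-cong a (λ i _ → *-identityˡ (g (suc i)))) ⟩
    (m * g 0 + g 0) + sumTo a (λ i → g (suc i))
  ≡⟨ +-assoc (m * g 0) (g 0) (sumTo a (λ i → g (suc i))) ⟩
    m * g 0 + (g 0 + sumTo a (λ i → g (suc i)))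
  ≡⟨ cong (m * g 0 +_) (sym (sumTo-suc a g)) ⟩
    m * g 0 + sumTo (suc a) g
  ∎

Comp-rSeq-diagonal : ∀ m n → Comp (rSeq m) n n ≡ (1 + m) ^ n
Comp-rSeq-diagonal m zero    = refl
Comp-rSeq-diagonal m (suc n) = begin
    Comp (rSeq m) (suc n) (suc n)
  ≡⟨ cong (λ x → Comp (rSeq m) x (suc n)) (sym (+-identityʳ (suc n))) ⟩
    Comp (rSeq m) (suc n + 0) (suc n)
  ≡⟨ Comp-suc (rSeq m) n 0 ⟩
    (1 + m) * Comp (rSeq m) (n + 0) n
  ≡⟨ cong (λ x → (1 + m) * Comp (rSeq m) x n) (+-identityʳ n) ⟩
    (1 + m) * Comp (rSeq m) n n
  ≡⟨ cong ((1 + m) *_) (Comp-rSeq-diagonal m n) ⟩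
    (1 + m) ^ suc n
  ∎

Comp-rSeq : ∀ m k a → Comp (rSeq m) (k + a) k ≡ binomialSum m k (weakCompositions a)
Comp-rSeq m zero    a = trans (Comp-zero (rSeq m) a) (sym (+-identityʳ (δ a)))
Comp-rSeq m (suc k) a = begin
    Comp (rSeq m) (suc k + a) (suc k)
  ≡⟨ Comp-suc (rSeq m) k a ⟩
    sumTo a (λ i → rSeq m i * Cₖ (a ∸ i))
  ≡⟨ sumTo-rSeq m a (λ i → Cₖ (a ∸ i)) ⟩
    m * Cₖ a + sumTo a (λ i → Cₖ (a ∸ i))
  ≡⟨ cong₂ _+_ (cong (m *_) (Comp-rSeq m k a)) (sumTo-cong a (λ i _ → Comp-rSeq m k (a ∸ i))) ⟩
    m * P (weakCompositions a) + sumTo a (λ i → P (weakCompositions (a ∸ i)))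
  ≡⟨ cong (m * P (weakCompositions a) +_) (binomialSum-sumTo m k a (λ i → weakCompositions (a ∸ i))) ⟩
    m * P (weakCompositions a) + P (λ j → sumTo a (λ i → weakCompositions (a ∸ i) j))
  ≡⟨ cong (m * P (weakCompositions a) +_) (binomialSum-cong m k (weakCompositions-suc a)) ⟩
    m * P (weakCompositions a) + P (λ j → weakCompositions a (suc j))
  ≡⟨ sym (binomialSum-suc m k (weakCompositions a)) ⟩
    binomialSum m (suc k) (weakCompositions a)
  ∎
  where
  Cₖ : ℕ → ℕ
  Cₖ b = Comp (rSeq m) (k + b) k
  P : (ℕ → ℕ) → ℕ
  P = binomialSum m k

binomialSum-weakCompositions : ∀ m k a → 0 < a →
  binomialSum m k (weakCompositions a) ≡
  sum1To k (λ i → (k C i) * ((a + i ∸ 1) C (i ∸ 1)) * m ^ (k ∸ i))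
binomialSum-weakCompositions m k (suc a) _ =
  sumTo≡sum1To k (*-zeroʳ ((k C 0) * m ^ k)) (λ i →
    trans (xy∙z≈xz∙y (k C suc i) (m ^ (k ∸ suc i)) ((suc a + i) C i))
          (cong (λ b → (k C suc i) * (b C i) * m ^ (k ∸ suc i)) (sym (+-suc a i))))

mainTheorem8 : (m : ℕ) →
    ((n : ℕ) → 0 < n → Comp (rSeq m) n n ≡ (1 + m) ^ n) ×
    ((n k : ℕ) → 0 < k → k < n →
      Comp (rSeq m) n k ≡ sum1To k (λ i → (k C i) * ((n ∸ k + i ∸ 1) C (i ∸ 1)) * m ^ (k ∸ i)))
mainTheorem8 m = (λ n _ → Comp-rSeq-diagonal m n) , offDiagonal
  where
  offDiagonal : (n k : ℕ) → 0 < k → k < n →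
    Comp (rSeq m) n k ≡ sum1To k (λ i → (k C i) * ((n ∸ k + i ∸ 1) C (i ∸ 1)) * m ^ (k ∸ i))
  offDiagonal n k _ k<n = begin
      Comp (rSeq m) n k
    ≡⟨ cong (λ x → Comp (rSeq m) x k) (sym (m+[n∸m]≡n (<⇒≤ k<n))) ⟩
      Comp (rSeq m) (k + (n ∸ k)) k
    ≡⟨ Comp-rSeq m k (n ∸ k) ⟩
      binomialSum m k (weakCompositions (n ∸ k))
    ≡⟨ binomialSum-weakCompositions m k (n ∸ k) (m<n⇒0<n∸m k<n) ⟩
      sum1To k (λ i → (k C i) * ((n ∸ k + i ∸ 1) C (i ∸ 1)) * m ^ (k ∸ i))
    ∎
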